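{- Let $D$ be a balanced bipartite digraph with colour classes $X,Y$ of cardinalities $a$, where $a\geq 2$, such that $d_D(u)+d_D(v)\geq 3a+1$ for every pair of distinct vertices $u,v$ with $uv\notin A(D)$ and $vu\notin A(D)$. Then for every set of vertices $S$ contained in one of the colour classes with $|S|\leq (a+1)/2$, we have $|N^+(S)|\geq |S|$.
   Context: A digraph has a finite vertex set and a set of arcs (ordered pairs of distinct vertices), with no loops or multiple arcs. $d_D(v)=d_D^+(v)+d_D^-(v)$ is the sum of outdegree and indegree. Bipartite with colour classes $X,Y$ means $V(D)=X\sqcup Y$ and all arcs go between $X$ and $Y$; balanced means $|X|=|Y|$. For $S\subset V(D)$, $N^+(S)=\{u\in V(D): vu\in A(D)\text{ for some } v\in S\}$. -}

module Defs where

open import Data.Nat using (ℕ; zero; suc; _+_)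
open import Data.Bool using (Bool; true; false; _∨_; _∧_)
open import Data.Fin using (Fin; zero; suc)
open import Data.Fin.Subset using (Subset; ∣_∣)
open import Data.Vec using (tabulate)
open import Relation.Binary.PropositionalEquality using (_≡_)
open import Relation.Nullary using (¬_)

-- A digraph on vertex set Fin n, given by its Boolean adjacency:
-- adj u v ≡ true  iff  uv is an arc.  No loops; no multiple arcs (automatic).
record Digraph (n : ℕ) : Set where
  field
    adj   : Fin n → Fin n → Bool
    loopless : ∀ v → adj v v ≡ false
open Digraph public

anyFin : ∀ {n} → (Fin n → Bool) → Bool
anyFin {zero}  f = false
anyFin {suc n} f = f zero ∨ anyFin (λ i → f (suc i))

outdeg : ∀ {n} → Digraph n → Fin n → ℕ
outdeg D v = ∣ tabulate (λ u → adj D v u) ∣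

indeg : ∀ {n} → Digraph n → Fin n → ℕ
indeg D v = ∣ tabulate (λ u → adj D u v) ∣

deg : ∀ {n} → Digraph n → Fin n → ℕ
deg D v = outdeg D v + indeg D v

N⁺ : ∀ {n} → Digraph n → Subset n → Subset n
N⁺ D S = tabulate (λ u → anyFin (λ v → Data.Vec.lookup S v ∧ adj D v u))

-- D is bipartite with colour classes X and its complement Y:
-- every arc joins a vertex of X to a vertex of Y.
IsBipartite : ∀ {n} → Digraph n → Subset n → Set
IsBipartite D X = ∀ u v → adj D u v ≡ true → ¬ (Data.Vec.lookup X u ≡ Data.Vec.lookup X v)

-- All out- and in-neighbours of a vertex v lie in the colour class
-- opposite to v, which has a vertices; so d(v) ≤ 2a, and for v ∈ S even
-- d(v) ≤ |N⁺(S)| + a, because N⁺(v) ⊆ N⁺(S).  Two vertices of the same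
-- colour are never adjacent, so the degree condition applies to them.
--   * If |S| ≥ 2, take distinct x, y ∈ S:  3a + 1 ≤ 2|N⁺(S)| + 2a, hence
--     a + 1 ≤ 2|N⁺(S)|, and 2|S| ≤ a + 1 gives |S| ≤ |N⁺(S)|.
--   * If |S| = 1, say S = {x}, take y ≠ x in the colour class of x (a ≥ 2):
--     3a + 1 ≤ (|N⁺(S)| + a) + 2a, hence |N⁺(S)| ≥ 1.
-- The file first collects set-theoretic facts about Subset, then the degree
-- bounds, then these two estimates, and derives lemma2p1 at the end.
module Submission where

open import Defs
open import Data.Nat using (ℕ; _+_; _*_; _≤_; _≥_)
open import Data.Bool using (false)
open import Data.Fin using (Fin)
open import Data.Fin.Subset using (Subset; ∣_∣; ∁; _⊆_)
open import Data.Sum using (_⊎_)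
open import Relation.Binary.PropositionalEquality using (_≡_; _≢_)

open import Data.Nat using (zero; suc; _<_; z≤n; s≤s)
open import Data.Nat.Properties
  using (≤-trans; +-mono-≤; *-cancelˡ-≤; +-cancelˡ-≤; <⇒≱)
open import Data.Nat.Solver using (module +-*-Solver)
open import Data.Bool using (Bool; true; if_then_else_; _∧_)
open import Data.Bool.Properties using (¬-not; ∨-zeroʳ)
open import Data.Fin.Properties using (¬∀⟶∃¬)
open import Data.Fin.Subset using (_∈_; _∉_; ⊥; ⁅_⁆)
open import Data.Fin.Subset.Properties
  using (_∈?_; p⊆q⇒∣p∣≤∣q∣; x∉p⇒x∈∁p; x∈∁p⇒x∉p; x∉⁅y⁆⇒x≢y; ∣⊥∣≡0; ∣⁅x⁆∣≡1)
open import Data.Vec using (lookup; tabulate)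
open import Data.Vec.Properties using ([]=⇒lookup; lookup⇒[]=; lookup∘tabulate)
open import Data.Product using (∃; _,_; _×_)
open import Data.Sum using (inj₁; inj₂)
open import Relation.Nullary using (contradiction)
open import Relation.Nullary.Decidable using (_→-dec_; decidable-stable)
open import Relation.Binary.PropositionalEquality using (refl; sym; trans; subst; subst₂)

lookup-∈ : ∀ {n} {p : Subset n} {u} → u ∈ p → lookup p u ≡ true
lookup-∈ = []=⇒lookup

lookup-∉ : ∀ {n} {p : Subset n} {u} → u ∉ p → lookup p u ≡ false
lookup-∉ {p = p} {u} u∉p = ¬-not (λ t → u∉p (lookup⇒[]= u p t))

∈-tabulate⁺ : ∀ {n} (f : Fin n → Bool) {u} → f u ≡ true → u ∈ tabulate f
∈-tabulate⁺ f {u} fu = lookup⇒[]= u (tabulate f) (trans (lookup∘tabulate f u) fu)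

∈-tabulate⁻ : ∀ {n} (f : Fin n → Bool) {u} → u ∈ tabulate f → f u ≡ true
∈-tabulate⁻ f {u} u∈ = trans (sym (lookup∘tabulate f u)) ([]=⇒lookup u∈)

anyFin-intro : ∀ {n} (f : Fin n → Bool) x → f x ≡ true → anyFin f ≡ true
anyFin-intro f Fin.zero fx rewrite fx = refl
anyFin-intro f (Fin.suc x) fx
  rewrite anyFin-intro (λ i → f (Fin.suc i)) x fx = ∨-zeroʳ (f Fin.zero)

element-outside : ∀ {n} (p q : Subset n) → ∣ q ∣ < ∣ p ∣ → ∃ λ y → y ∈ p × y ∉ q
element-outside {n} p q q<p
  with ¬∀⟶∃¬ n (λ y → y ∈ p → y ∈ q) (λ y → (y ∈? p) →-dec (y ∈? q))
         (λ p⊆q → <⇒≱ q<p (p⊆q⇒∣p∣≤∣q∣ (p⊆q _)))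
... | y , y∉⇒ = y , decidable-stable (y ∈? p) (λ y∉p → y∉⇒ (λ y∈p → contradiction y∈p y∉p))
                  , (λ y∈q → y∉⇒ (λ _ → y∈q))

element : ∀ {n} (p : Subset n) → 0 < ∣ p ∣ → ∃ λ x → x ∈ p
element {n} p 0<p with x , x∈p , _ ← element-outside p ⊥ (subst (_< ∣ p ∣) (sym (∣⊥∣≡0 n)) 0<p)
  = x , x∈p

another-element : ∀ {n} (p : Subset n) x → 1 < ∣ p ∣ → ∃ λ y → y ∈ p × x ≢ y
another-element p x 1<p
  with y , y∈p , y∉⁅x⁆ ← element-outside p ⁅ x ⁆ (subst (_< ∣ p ∣) (sym (∣⁅x⁆∣≡1 x)) 1<p)
  = y , y∈p , (λ x≡y → x∉⁅y⁆⇒x≢y y∉⁅x⁆ (sym x≡y))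

opposite : ∀ {n} → Subset n → Fin n → Subset n
opposite X v = if lookup X v then ∁ X else X

∈-opposite : ∀ {n} (X : Subset n) {u v} → lookup X u ≢ lookup X v → u ∈ opposite X v
∈-opposite X {u} {v} u≢v with lookup X v | lookup X u in colour-u
... | true  | true  = contradiction refl u≢v
... | true  | false = x∉p⇒x∈∁p (λ u∈X → contradiction (trans (sym colour-u) (lookup-∈ u∈X)) λ ())
... | false | true  = lookup⇒[]= u X colour-u
... | false | false = contradiction refl u≢v

∣opposite∣ : ∀ {n} (X : Subset n) {a} → ∣ X ∣ ≡ a → ∣ ∁ X ∣ ≡ a → ∀ v → ∣ opposite X v ∣ ≡ a
∣opposite∣ X ∣X∣≡a ∣∁X∣≡a v with lookup X v
... | true  = ∣∁X∣≡a
... | false = ∣X∣≡a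

module Arithmetic where
  open +-*-Solver

  halve-excess : ∀ a N → 3 * a + 1 ≤ (N + a) + (N + a) → a + 1 ≤ 2 * N
  halve-excess a N h = +-cancelˡ-≤ (a + a) (a + 1) (2 * N)
    (subst₂ _≤_ (solve 1 (λ a → con 3 :* a :+ con 1 := (a :+ a) :+ (a :+ con 1)) refl a)
                (solve 2 (λ a N → (N :+ a) :+ (N :+ a) := (a :+ a) :+ con 2 :* N) refl a N) h)

  positive-excess : ∀ a N → 3 * a + 1 ≤ (N + a) + (a + a) → 1 ≤ N
  positive-excess a N h = +-cancelˡ-≤ (3 * a) 1 N
    (subst (3 * a + 1 ≤_) (solve 2 (λ a N → (N :+ a) :+ (a :+ a) := con 3 :* a :+ N) refl a N) h)

open Arithmetic

module _ {n} (D : Digraph n) (X : Subset n) (bip : IsBipartite D X) where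

  same-colour-no-arc : ∀ u v → lookup X u ≡ lookup X v → adj D u v ≡ false
  same-colour-no-arc u v same = ¬-not (λ arc → bip u v arc same)

  outdeg≤opposite : ∀ v → outdeg D v ≤ ∣ opposite X v ∣
  outdeg≤opposite v = p⊆q⇒∣p∣≤∣q∣ λ u∈ →
    ∈-opposite X (λ e → bip v _ (∈-tabulate⁻ (adj D v) u∈) (sym e))

  indeg≤opposite : ∀ v → indeg D v ≤ ∣ opposite X v ∣
  indeg≤opposite v = p⊆q⇒∣p∣≤∣q∣ λ u∈ →
    ∈-opposite X (bip _ v (∈-tabulate⁻ (λ u → adj D u v) u∈))

outdeg≤∣N⁺∣ : ∀ {n} (D : Digraph n) (S : Subset n) {x} → x ∈ S → outdeg D x ≤ ∣ N⁺ D S ∣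
outdeg≤∣N⁺∣ D S {x} x∈S = p⊆q⇒∣p∣≤∣q∣ λ {u} u∈ →
  ∈-tabulate⁺ _ (anyFin-intro (λ v → lookup S v ∧ adj D v u) x
    (subst (λ b → b ∧ adj D x u ≡ true) (sym (lookup-∈ x∈S)) (∈-tabulate⁻ (adj D x) u∈)))

module Balanced {n} (D : Digraph n) (X : Subset n) (a : ℕ)
  (bip : IsBipartite D X) (∣X∣≡a : ∣ X ∣ ≡ a) (∣∁X∣≡a : ∣ ∁ X ∣ ≡ a)
  (ore : ∀ u v → u ≢ v → adj D u v ≡ false → adj D v u ≡ false →
           deg D u + deg D v ≥ 3 * a + 1) where

  outdeg≤a : ∀ v → outdeg D v ≤ a
  outdeg≤a v = subst (_ ≤_) (∣opposite∣ X ∣X∣≡a ∣∁X∣≡a v) (outdeg≤opposite D X bip v)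

  indeg≤a : ∀ v → indeg D v ≤ a
  indeg≤a v = subst (_ ≤_) (∣opposite∣ X ∣X∣≡a ∣∁X∣≡a v) (indeg≤opposite D X bip v)

  deg≤2a : ∀ v → deg D v ≤ a + a
  deg≤2a v = +-mono-≤ (outdeg≤a v) (indeg≤a v)

  deg≤∣N⁺∣+a : ∀ S {x} → x ∈ S → deg D x ≤ ∣ N⁺ D S ∣ + a
  deg≤∣N⁺∣+a S x∈S = +-mono-≤ (outdeg≤∣N⁺∣ D S x∈S) (indeg≤a _)

  ore-same-colour : ∀ x y → x ≢ y → lookup X x ≡ lookup X y → 3 * a + 1 ≤ deg D x + deg D y
  ore-same-colour x y x≢y same =
    ore x y x≢y (same-colour-no-arc D X bip x y same) (same-colour-no-arc D X bip y x (sym same))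

  two-in-S : ∀ S {x y} → x ∈ S → y ∈ S → x ≢ y → lookup X x ≡ lookup X y →
             a + 1 ≤ 2 * ∣ N⁺ D S ∣
  two-in-S S {x} {y} x∈S y∈S x≢y same = halve-excess a ∣ N⁺ D S ∣
    (≤-trans (ore-same-colour x y x≢y same)
             (+-mono-≤ (deg≤∣N⁺∣+a S x∈S) (deg≤∣N⁺∣+a S y∈S)))

  one-in-S : ∀ S {x y} → x ∈ S → x ≢ y → lookup X x ≡ lookup X y → 1 ≤ ∣ N⁺ D S ∣
  one-in-S S {x} {y} x∈S x≢y same = positive-excess a ∣ N⁺ D S ∣
    (≤-trans (ore-same-colour x y x≢y same) (+-mono-≤ (deg≤∣N⁺∣+a S x∈S) (deg≤2a y)))

  -- The theorem for a subset S of a monochromatic set C of size a ≥ 2,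
  -- by cases on |S|: empty (trivial), a singleton (partner taken from C),
  -- or at least two elements (cancel 2 in 2|S| ≤ a + 1 ≤ 2|N⁺(S)|).
  expansion : 2 ≤ a → (C : Subset n) → ∣ C ∣ ≡ a →
              (∀ {u v} → u ∈ C → v ∈ C → lookup X u ≡ lookup X v) →
              ∀ S → S ⊆ C → 2 * ∣ S ∣ ≤ a + 1 → ∣ N⁺ D S ∣ ≥ ∣ S ∣
  expansion 2≤a C ∣C∣≡a mono S S⊆C small with ∣ S ∣ in ∣S∣≡s
  ... | zero = z≤n
  ... | suc zero
    with x , x∈S ← element S (subst (0 <_) (sym ∣S∣≡s) (s≤s z≤n))
    with y , y∈C , x≢y ← another-element C x (subst (1 <_) (sym ∣C∣≡a) 2≤a)
    = one-in-S S x∈S x≢y (mono (S⊆C x∈S) y∈C)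
  ... | suc (suc k)
    with x , x∈S ← element S (subst (0 <_) (sym ∣S∣≡s) (s≤s z≤n))
    with y , y∈S , x≢y ← another-element S x (subst (1 <_) (sym ∣S∣≡s) (s≤s (s≤s z≤n)))
    = *-cancelˡ-≤ 2 (≤-trans small (two-in-S S x∈S y∈S x≢y (mono (S⊆C x∈S) (S⊆C y∈S))))

lemma2p1 : ∀ {n} (D : Digraph n) (X : Subset n) (a : ℕ) →
    IsBipartite D X → ∣ X ∣ ≡ a → ∣ ∁ X ∣ ≡ a → 2 ≤ a →
    (∀ u v → u ≢ v → adj D u v ≡ false → adj D v u ≡ false →
      deg D u + deg D v ≥ 3 * a + 1) →
    ∀ (S : Subset n) → (S ⊆ X ⊎ S ⊆ ∁ X) → 2 * ∣ S ∣ ≤ a + 1 →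
    ∣ N⁺ D S ∣ ≥ ∣ S ∣
lemma2p1 D X a bip ∣X∣≡a ∣∁X∣≡a 2≤a ore S (inj₁ S⊆X) =
  expansion 2≤a X ∣X∣≡a (λ u∈X v∈X → trans (lookup-∈ u∈X) (sym (lookup-∈ v∈X))) S S⊆X
  where open Balanced D X a bip ∣X∣≡a ∣∁X∣≡a ore
lemma2p1 D X a bip ∣X∣≡a ∣∁X∣≡a 2≤a ore S (inj₂ S⊆∁X) =
  expansion 2≤a (∁ X) ∣∁X∣≡a (λ u∈∁X v∈∁X → trans (lookup-∉ (x∈∁p⇒x∉p u∈∁X))
                                                  (sym (lookup-∉ (x∈∁p⇒x∉p v∈∁X)))) S S⊆∁X
  where open Balanced D X a bip ∣X∣≡a ∣∁X∣≡a ore
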